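{- Let $G$ be a connected finite simple graph of order $n \ge 4$. Then $G \cong K_{1,n-1}$ if and only if $\gamma(M(G)) = n-1$.
   Context: $K_{1,n-1}$ is the star with one central vertex adjacent to $n-1$ leaves. For a finite simple graph $H$, the middle graph $M(H)$ is the graph with vertex set $V(H)\cup E(H)$ in which two elements $x,y$ are adjacent if and only if either (1) $x,y\in E(H)$ and the edges $x,y$ share a common endpoint in $H$, or (2) $x\in V(H)$, $y\in E(H)$ and $x$ is an endpoint of $y$ (or vice versa). A dominating set of a graph $H$ is a set $S\subseteq V(H)$ such that every vertex of $H$ is in $S$ or adjacent to a vertex of $S$; the domination number $\gamma(H)$ is the minimum cardinality of a dominating set of $H$. -}

module Defs where

open import Data.Nat using (ℕ; zero; suc; _≤_; _≡ᵇ_)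
open import Data.Fin using (Fin; toℕ) renaming (_<_ to _<ᶠ_)
open import Data.Bool using (Bool; true; false; T; _∧_; _∨_; not)
open import Data.Product using (Σ; ∃; _×_; _,_; proj₁; proj₂)
open import Data.Sum using (_⊎_; inj₁; inj₂)
open import Data.Empty using (⊥)
open import Data.List using (List; length)
open import Data.List.Relation.Unary.Any using (Any)
open import Data.List.Relation.Unary.Unique.Propositional using (Unique)
open import Relation.Nullary using (¬_)
open import Relation.Binary.PropositionalEquality using (_≡_)
open import Function.Bundles using (_↔_; Inverse)

record Graph (V : Set) : Set₁ where
  field
    Adj : V → V → Set

record SimpleGraph (n : ℕ) : Set where
  field
    adj   : Fin n → Fin n → Bool
    sym   : ∀ u v → adj u v ≡ adj v u
    irrefl : ∀ v → adj v v ≡ false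
open SimpleGraph public

data Reachable {n : ℕ} (G : SimpleGraph n) : Fin n → Fin n → Set where
  here : ∀ {u} → Reachable G u u
  step : ∀ {u v w} → T (adj G u v) → Reachable G v w → Reachable G u w

Connected : ∀ {n} → SimpleGraph n → Set
Connected G = ∀ u v → Reachable G u v

-- The star K_{1,n-1} on Fin n with centre the vertex of index 0.
isCentre : ∀ {n} → Fin n → Bool
isCentre v = toℕ v ≡ᵇ 0

starAdj : ∀ {n} → Fin n → Fin n → Bool
starAdj u v = (isCentre u ∧ not (isCentre v)) ∨ (isCentre v ∧ not (isCentre u))

starAdj-sym : ∀ {n} (u v : Fin n) → starAdj u v ≡ starAdj v u
starAdj-sym u v with isCentre u | isCentre v
... | true  | true  = _≡_.refl
... | true  | false = _≡_.refl
... | false | true  = _≡_.refl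
... | false | false = _≡_.refl

starAdj-irrefl : ∀ {n} (v : Fin n) → starAdj v v ≡ false
starAdj-irrefl v with isCentre v
... | true  = _≡_.refl
... | false = _≡_.refl

Star : (n : ℕ) → SimpleGraph n
Star n = record { adj = starAdj ; sym = starAdj-sym ; irrefl = starAdj-irrefl }

_≅_ : ∀ {n} → SimpleGraph n → SimpleGraph n → Set
_≅_ {n} G H = Σ (Fin n ↔ Fin n) λ f →
  ∀ u v → adj G u v ≡ adj H (Inverse.to f u) (Inverse.to f v)

-- Edges of G: unordered pairs {u,v}, represented as (u,v) with u < v.
Edge : ∀ {n} → SimpleGraph n → Set
Edge {n} G = Σ (Fin n × Fin n) λ p → (proj₁ p <ᶠ proj₂ p) × T (adj G (proj₁ p) (proj₂ p))

Incident : ∀ {n} {G : SimpleGraph n} → Fin n → Edge G → Set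
Incident v ((a , b) , _) = (v ≡ a) ⊎ (v ≡ b)

middleAdj : ∀ {n} (G : SimpleGraph n) → (Fin n ⊎ Edge G) → (Fin n ⊎ Edge G) → Set
middleAdj G (inj₁ _) (inj₁ _) = ⊥
middleAdj G (inj₁ v) (inj₂ e) = Incident {G = G} v e
middleAdj G (inj₂ e) (inj₁ v) = Incident {G = G} v e
middleAdj G (inj₂ e) (inj₂ f) = (¬ proj₁ e ≡ proj₁ f) × ∃ λ v → Incident {G = G} v e × Incident {G = G} v f

Middle : ∀ {n} (G : SimpleGraph n) → Graph (Fin n ⊎ Edge G)
Middle G = record { Adj = middleAdj G }

-- Domination.  A vertex set is a duplicate-free list.
Dominating : ∀ {V} → Graph V → List V → Set
Dominating H S = ∀ x → Any (λ s → (s ≡ x) ⊎ Graph.Adj H s x) S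

IsDominationNumber : ∀ {V} → Graph V → ℕ → Set
IsDominationNumber H k =
  (Σ (List _) λ S → Unique S × Dominating H S × length S ≡ k) ×
  (∀ S → Unique S → Dominating H S → k ≤ length S)

module Submission where

open import Defs hiding (sym)
open import Data.Nat using (ℕ; suc; _+_; _≤_; _∸_; s≤s)
open import Data.Nat.Properties using (≮⇒≥; n≮n)
open import Data.Fin using (Fin; zero; suc; punchIn; punchOut; _≟_) renaming (_<_ to _<ᶠ_)
open import Data.Fin.Patterns using (0F; 1F; 2F; 3F)
open import Data.Fin.Properties
  using (pigeonhole; <-cmp; <⇒≢; <-asym; <-irrelevant; punchIn-injective; punchInᵢ≢i;
         punchOut-injective; punchIn-punchOut)
open import Data.Fin.Permutation using (transpose)
open import Data.Bool using (true; false; T)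
open import Data.Bool.Properties using (T-irrelevant; T-≡)
open import Data.Product using (Σ; ∃₂; _×_; _,_; proj₁; proj₂)
open import Data.Product.Properties using (≡-dec)
open import Data.Sum using (_⊎_; inj₁; inj₂)
open import Data.Sum.Properties using (inj₁-injective; inj₂-injective)
open import Data.Empty using (⊥; ⊥-elim)
open import Data.List using (List; []; _∷_; map; length; tabulate; allFin; lookup)
open import Data.List.Properties using (length-map; length-tabulate)
open import Data.List.Relation.Unary.Any as Any using (Any; here; there)
open import Data.List.Relation.Unary.Any.Properties using (lookup-index)
open import Data.List.Relation.Unary.All using (All; []; _∷_; universal)
open import Data.List.Relation.Unary.All.Properties using (¬Any⇒All¬; All¬⇒¬Any)
import Data.List.Relation.Unary.All.Properties as All
open import Data.List.Relation.Unary.AllPairs using ([]; _∷_)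
open import Data.List.Relation.Unary.Unique.Propositional using (Unique)
import Data.List.Relation.Unary.Unique.Propositional.Properties as Unique
open import Data.List.Membership.Propositional using (_∈_; _∉_; lose)
open import Data.List.Membership.Propositional.Properties using (∈-map⁺; ∈-tabulate⁺)
open import Function using (_∘_)
open import Function.Bundles using (_⇔_; _↔_; mk⇔; Inverse; Equivalence)
open import Relation.Nullary using (¬_; yes; no)
open import Relation.Binary.Definitions using (tri<; tri≈; tri>)
open import Relation.Binary.PropositionalEquality

Dominates : ∀ {V} → Graph V → V → V → Set
Dominates H s x = (s ≡ x) ⊎ Graph.Adj H s x

-- If no vertex dominates two of the k vertices f i (their closed
-- neighbourhoods are pairwise disjoint), every dominating set has at least
-- k elements: choosing a dominator in S for each f i is injective.
dominating-lower-bound : ∀ {V} (H : Graph V) {k} (f : Fin k → V) →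
  (∀ s {i j} → Dominates H s (f i) → Dominates H s (f j) → i ≡ j) →
  ∀ S → Dominating H S → k ≤ length S
dominating-lower-bound H {k} f separated S dom =
  ≮⇒≥ λ S<k → collision (pigeonhole S<k dominator)
  where
  dominator : Fin k → Fin (length S)
  dominator i = Any.index (dom (f i))

  dominates : ∀ i → Dominates H (lookup S (dominator i)) (f i)
  dominates i = lookup-index (dom (f i))

  collision : ∃₂ (λ i j → i <ᶠ j × dominator i ≡ dominator j) → ⊥
  collision (i , j , i<j , same) =
    <⇒≢ i<j (separated _ (subst (λ p → Dominates H (lookup S p) (f i)) same (dominates i))
                         (dominates j))

module _ {n} {x : Fin (suc n)} where

  punchOuts : ∀ {xs} → All (x ≢_) xs → List (Fin n)
  punchOuts []       = []
  punchOuts (p ∷ ps) = punchOut p ∷ punchOuts ps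

  length-punchOuts : ∀ {xs} (ps : All (x ≢_) xs) → length (punchOuts ps) ≡ length xs
  length-punchOuts []       = refl
  length-punchOuts (_ ∷ ps) = cong suc (length-punchOuts ps)

  ∈-punchOuts⁻ : ∀ {xs y} (ps : All (x ≢_) xs) (p : x ≢ y) → punchOut p ∈ punchOuts ps → y ∈ xs
  ∈-punchOuts⁻ (q ∷ ps) p (here eq) = here (punchOut-injective p q eq)
  ∈-punchOuts⁻ (q ∷ ps) p (there m) = there (∈-punchOuts⁻ ps p m)

  -- punchOut is injective, so re-indexing keeps a list duplicate-free
  punchOuts-unique : ∀ {xs} (ps : All (x ≢_) xs) → Unique xs → Unique (punchOuts ps)
  punchOuts-unique []       []        = []
  punchOuts-unique (p ∷ ps) (y∉ ∷ u) =
    ¬Any⇒All¬ _ (λ m → All¬⇒¬Any y∉ (∈-punchOuts⁻ ps p m)) ∷ punchOuts-unique ps u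

record Complement {n} (xs : List (Fin n)) : Set where
  constructor complement-of
  field
    points     : List (Fin n)
    unique     : Unique points
    length-sum : length xs + length points ≡ n
    covers     : ∀ v → v ∉ xs → v ∈ points

-- Every duplicate-free list has a complement.  By induction on the list:
-- the complement of x ∷ xs is the complement of xs re-indexed around x.
complement : ∀ {n} (xs : List (Fin n)) → Unique xs → Complement xs
complement {n} [] _ =
  complement-of (allFin n) (Unique.allFin⁺ n) (length-tabulate (λ i → i)) (λ v _ → ∈-tabulate⁺ v)
complement {suc n} (x ∷ xs) (x∉xs ∷ u)
  with complement (punchOuts x∉xs) (punchOuts-unique x∉xs u)
... | complement-of ys ys-unique len covers =
  complement-of (map (punchIn x) ys) (Unique.map⁺ (punchIn-injective x _ _) ys-unique) (cong suc len′) covers′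
  where
  open ≡-Reasoning
  len′ : length xs + length (map (punchIn x) ys) ≡ n
  len′ = begin
    length xs + length (map (punchIn x) ys)      ≡⟨ cong₂ _+_ (sym (length-punchOuts x∉xs)) (length-map _ ys) ⟩
    length (punchOuts x∉xs) + length ys          ≡⟨ len ⟩
    n                                            ∎

  covers′ : ∀ v → v ∉ x ∷ xs → v ∈ map (punchIn x) ys
  covers′ v v∉ with x ≟ v
  ... | yes x≡v = ⊥-elim (v∉ (here (sym x≡v)))
  ... | no  x≢v = subst (_∈ map (punchIn x) ys) (punchIn-punchOut x≢v)
                    (∈-map⁺ (punchIn x) (covers _ (v∉ ∘ there ∘ ∈-punchOuts⁻ x∉xs x≢v)))

endpoints-of : ∀ {A : Set} {a b x y : A} → x ≢ y →
  (x ≡ a) ⊎ (x ≡ b) → (y ≡ a) ⊎ (y ≡ b) → (x ≡ a × y ≡ b) ⊎ (x ≡ b × y ≡ a)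
endpoints-of x≢y (inj₁ p) (inj₁ q) = ⊥-elim (x≢y (trans p (sym q)))
endpoints-of _   (inj₁ p) (inj₂ q) = inj₁ (p , q)
endpoints-of _   (inj₂ p) (inj₁ q) = inj₂ (p , q)
endpoints-of x≢y (inj₂ p) (inj₂ q) = ⊥-elim (x≢y (trans p (sym q)))

three-into-two : ∀ {A : Set} {u v x y z : A} → x ≢ y → x ≢ z → y ≢ z →
  (x ≡ u) ⊎ (x ≡ v) → (y ≡ u) ⊎ (y ≡ v) → (z ≡ u) ⊎ (z ≡ v) → ⊥
three-into-two xy _  _  (inj₁ p) (inj₁ q) _        = xy (trans p (sym q))
three-into-two xy _  _  (inj₂ p) (inj₂ q) _        = xy (trans p (sym q))
three-into-two _  xz _  (inj₁ p) (inj₂ _) (inj₁ r) = xz (trans p (sym r))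
three-into-two _  _  yz (inj₁ _) (inj₂ q) (inj₂ r) = yz (trans q (sym r))
three-into-two _  xz _  (inj₂ p) (inj₁ _) (inj₂ r) = xz (trans p (sym r))
three-into-two _  _  yz (inj₂ _) (inj₁ q) (inj₁ r) = yz (trans q (sym r))

sorted-pair-unique : ∀ {n} {a b a′ b′ x y : Fin n} → a <ᶠ b → a′ <ᶠ b′ →
  (x ≡ a × y ≡ b) ⊎ (x ≡ b × y ≡ a) → (x ≡ a′ × y ≡ b′) ⊎ (x ≡ b′ × y ≡ a′) →
  (a , b) ≡ (a′ , b′)
sorted-pair-unique _   _     (inj₁ (refl , refl)) (inj₁ (refl , refl)) = refl
sorted-pair-unique _   _     (inj₂ (refl , refl)) (inj₂ (refl , refl)) = refl
sorted-pair-unique a<b a′<b′ (inj₁ (refl , refl)) (inj₂ (refl , refl)) = ⊥-elim (<-asym a<b a′<b′)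
sorted-pair-unique a<b a′<b′ (inj₂ (refl , refl)) (inj₁ (refl , refl)) = ⊥-elim (<-asym a<b a′<b′)

module _ {n} (G : SimpleGraph n) where

  _∈ₑ_ : Fin n → Edge G → Set
  x ∈ₑ e = Incident {G = G} x e

  adj-sym : ∀ {u v} → T (adj G u v) → T (adj G v u)
  adj-sym {u} {v} = subst T (SimpleGraph.sym G u v)

  adj⇒≢ : ∀ {u v} → T (adj G u v) → u ≢ v
  adj⇒≢ {u} t refl = subst T (irrefl G u) t

  record EdgeBetween (u v : Fin n) : Set where
    constructor edge-between
    field
      edge      : Edge G
      first-end : u ∈ₑ edge
      other-end : v ∈ₑ edge
      ends-only : ∀ x → x ∈ₑ edge → (x ≡ u) ⊎ (x ≡ v)

  edgeBetween : ∀ u v → T (adj G u v) → EdgeBetween u v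
  edgeBetween u v t with <-cmp u v
  ... | tri< u<v _ _ = edge-between ((u , v) , u<v , t) (inj₁ refl) (inj₂ refl) (λ _ p → p)
  ... | tri≈ _ u≡v _ = ⊥-elim (adj⇒≢ t u≡v)
  ... | tri> _ _ v<u = edge-between ((v , u) , v<u , adj-sym t) (inj₂ refl) (inj₁ refl)
                         λ { _ (inj₁ p) → inj₂ p ; _ (inj₂ p) → inj₁ p }

  edge-ext : (e f : Edge G) → proj₁ e ≡ proj₁ f → e ≡ f
  edge-ext ((a , b) , a<b , t) (.(a , b) , a<b′ , t′) refl
    rewrite <-irrelevant a<b a<b′ | T-irrelevant t t′ = refl

  edge-determined : ∀ {x y} (e f : Edge G) → x ≢ y → x ∈ₑ e → y ∈ₑ e → x ∈ₑ f → y ∈ₑ f → e ≡ f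
  edge-determined e@(_ , a<b , _) f@(_ , a′<b′ , _) x≢y xe ye xf yf =
    edge-ext e f (sorted-pair-unique a<b a′<b′ (endpoints-of x≢y xe ye) (endpoints-of x≢y xf yf))

  endpoints-adjacent : ∀ (e : Edge G) {x y} → x ∈ₑ e → y ∈ₑ e → x ≢ y → T (adj G x y)
  endpoints-adjacent (_ , _ , t) xe ye x≢y with endpoints-of x≢y xe ye
  ... | inj₁ (refl , refl) = t
  ... | inj₂ (refl , refl) = adj-sym t

  touching-edges : ∀ {x} (e f : Edge G) → x ∈ₑ e → x ∈ₑ f → Dominates (Middle G) (inj₂ e) (inj₂ f)
  touching-edges {x} e f xe xf with ≡-dec _≟_ _≟_ (proj₁ e) (proj₁ f)
  ... | yes same = inj₁ (cong inj₂ (edge-ext e f same))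
  ... | no  differ = inj₂ (differ , x , xe , xf)

-- In a connected graph with at least two vertices every vertex has a
-- neighbour: the first step of a walk to some other vertex.
neighbour : ∀ {k} (G : SimpleGraph (suc (suc k))) → Connected G → ∀ v → Σ _ λ w → T (adj G v w)
neighbour G connected v = first-step (connected v (other v)) (other≢ v)
  where
  other : Fin _ → Fin _
  other zero    = 1F
  other (suc _) = 0F

  other≢ : ∀ v → v ≢ other v
  other≢ zero    ()
  other≢ (suc _) ()

  first-step : ∀ {u w} → Reachable G u w → u ≢ w → Σ _ λ x → T (adj G u x)
  first-step here         u≢w = ⊥-elim (u≢w refl)
  first-step (step t _) _   = _ , t

record IsStarCentre {n} (G : SimpleGraph n) (c : Fin n) : Set where
  constructor star-centred
  field
    hub          : ∀ v → v ≢ c → T (adj G c v)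
    avoids-none  : ∀ u v → u ≢ c → v ≢ c → ¬ T (adj G u v)

star-centre : ∀ {n} → IsStarCentre (Star (suc n)) 0F
star-centre = star-centred hub noEdge
  where
  hub : ∀ v → v ≢ 0F → T (starAdj 0F v)
  hub zero    v≢0 = ⊥-elim (v≢0 refl)
  hub (suc _) _   = _

  noEdge : ∀ u v → u ≢ 0F → v ≢ 0F → ¬ T (starAdj u v)
  noEdge zero    _       u≢0 _   = ⊥-elim (u≢0 refl)
  noEdge (suc _) zero    _   v≢0 = ⊥-elim (v≢0 refl)
  noEdge (suc _) (suc _) _   _   ()

pullback-centre : ∀ {n} {G H : SimpleGraph n} (f : Fin n ↔ Fin n) →
  (∀ u v → adj G u v ≡ adj H (Inverse.to f u) (Inverse.to f v)) →
  ∀ {c} → IsStarCentre H c → IsStarCentre G (Inverse.from f c)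
pullback-centre {G = G} {H} f preserves {c} (star-centred hub noEdge) = star-centred hub′ noEdge′
  where
  open Inverse f
  transport : ∀ {u v} → T (adj H (to u) (to v)) → T (adj G u v)
  transport {u} {v} = subst T (sym (preserves u v))

  to≢c : ∀ {v} → v ≢ from c → to v ≢ c
  to≢c {v} v≢ to-v≡c = v≢ (trans (sym (strictlyInverseʳ v)) (cong from to-v≡c))

  hub′ : ∀ v → v ≢ from c → T (adj G (from c) v)
  hub′ v v≢ = transport (subst (λ w → T (adj H w (to v))) (sym (strictlyInverseˡ c)) (hub (to v) (to≢c v≢)))

  noEdge′ : ∀ u v → u ≢ from c → v ≢ from c → ¬ T (adj G u v)
  noEdge′ u v u≢ v≢ t = noEdge (to u) (to v) (to≢c u≢) (to≢c v≢) (subst T (preserves u v) t)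

T⇒≡true : ∀ {b} → T b → b ≡ true
T⇒≡true = Equivalence.to T-≡

¬T⇒≡false : ∀ {b} → ¬ T b → b ≡ false
¬T⇒≡false {false} _  = refl
¬T⇒≡false {true}  ¬t = ⊥-elim (¬t _)

centre-determines : ∀ {n} {G H : SimpleGraph n} {c} → IsStarCentre G c → IsStarCentre H c →
  ∀ u v → adj G u v ≡ adj H u v
centre-determines {G = G} {H} {c} (star-centred hubG noEdgeG) (star-centred hubH noEdgeH) u v
  with u ≟ c | v ≟ c
... | yes refl | yes refl = trans (irrefl G c) (sym (irrefl H c))
... | yes refl | no  v≢c  = trans (T⇒≡true (hubG v v≢c)) (sym (T⇒≡true (hubH v v≢c)))
... | no  u≢c  | yes refl = trans (SimpleGraph.sym G u c)
                              (trans (T⇒≡true (hubG u u≢c)) (sym (trans (SimpleGraph.sym H u c) (T⇒≡true (hubH u u≢c)))))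
... | no  u≢c  | no  v≢c  = trans (¬T⇒≡false (noEdgeG u v u≢c v≢c)) (sym (¬T⇒≡false (noEdgeH u v u≢c v≢c)))

relabel : ∀ {n} → (Fin n ↔ Fin n) → SimpleGraph n → SimpleGraph n
relabel f H = record
  { adj    = λ u v → adj H (Inverse.to f u) (Inverse.to f v)
  ; sym    = λ u v → SimpleGraph.sym H _ _
  ; irrefl = λ v → irrefl H _
  }

star-iso⇒centre : ∀ {n} (G : SimpleGraph (suc n)) → G ≅ Star (suc n) → Σ _ (IsStarCentre G)
star-iso⇒centre G (f , preserves) = _ , pullback-centre f preserves star-centre

-- Conversely, swapping c with 0 maps G onto the star centred at 0.
centre⇒star-iso : ∀ {n} (G : SimpleGraph (suc n)) {c} → IsStarCentre G c → G ≅ Star (suc n)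
centre⇒star-iso {n} G {c} centre = τ , centre-determines centre relabelled-centre
  where
  τ : Fin (suc n) ↔ Fin (suc n)
  τ = transpose c 0F
  relabelled-centre : IsStarCentre (relabel τ (Star (suc n))) c
  relabelled-centre = pullback-centre τ (λ _ _ → refl) star-centre

-- (⇒) In a graph with star centre c on n = k + 2 vertices, the k + 1 edges
-- at c ("spokes") form a minimum dominating set of M(G).
module StarDomination {k} (G : SimpleGraph (suc (suc k))) {c} (centre : IsStarCentre G c) where
  open IsStarCentre centre
  open EdgeBetween

  leaf : Fin (suc k) → Fin (suc (suc k))
  leaf = punchIn c

  leaf≢c : ∀ i → leaf i ≢ c
  leaf≢c = punchInᵢ≢i c

  spoke-edge : ∀ i → EdgeBetween G c (leaf i)
  spoke-edge i = edgeBetween G c (leaf i) (hub (leaf i) (leaf≢c i))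

  spoke : Fin (suc k) → Edge G
  spoke i = edge (spoke-edge i)

  spoke′ : Fin (suc k) → Fin (suc (suc k)) ⊎ Edge G
  spoke′ = inj₂ ∘ spoke

  spokes : List (Fin (suc (suc k)) ⊎ Edge G)
  spokes = tabulate spoke′

  -- distinct leaves give distinct spokes, as a spoke has only two ends
  spoke-injective : ∀ {i j} → spoke′ i ≡ spoke′ j → i ≡ j
  spoke-injective {i} {j} eq with ends-only (spoke-edge j) (leaf i)
                                   (subst (_∈ₑ_ G (leaf i)) (inj₂-injective eq) (other-end (spoke-edge i)))
  ... | inj₁ leaf-i≡c = ⊥-elim (leaf≢c i leaf-i≡c)
  ... | inj₂ same     = punchIn-injective c i j same

  w∈spoke : ∀ {w} (c≢w : c ≢ w) → _∈ₑ_ G w (spoke (punchOut c≢w))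
  w∈spoke c≢w = subst (λ x → _∈ₑ_ G x (spoke (punchOut c≢w))) (punchIn-punchOut c≢w)
                      (other-end (spoke-edge (punchOut c≢w)))

  spoke-through : ∀ e {w} → _∈ₑ_ G c e → _∈ₑ_ G w e → (c≢w : c ≢ w) → spoke (punchOut c≢w) ≡ e
  spoke-through e ce we c≢w = edge-determined G (spoke _) e c≢w (first-end (spoke-edge _)) (w∈spoke c≢w) ce we

  -- Every edge contains c, so every edge is a spoke.
  edge-is-spoke : ∀ (e : Edge G) → Σ (Fin (suc k)) λ i → spoke i ≡ e
  edge-is-spoke e@((a , b) , _ , t) with a ≟ c | b ≟ c
  ... | yes refl | _        = _ , spoke-through e (inj₁ refl) (inj₂ refl) (adj⇒≢ G t)
  ... | no _     | yes refl = _ , spoke-through e (inj₂ refl) (inj₁ refl) (adj⇒≢ G t ∘ sym)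
  ... | no a≢c   | no b≢c   = ⊥-elim (avoids-none a b a≢c b≢c t)

  -- vertices lie on spokes, and every edge is itself a spoke
  spokes-dominate : Dominating (Middle G) spokes
  spokes-dominate (inj₁ v) with c ≟ v
  ... | yes refl = here (inj₂ (first-end (spoke-edge 0F)))
  ... | no  c≢v  = lose (∈-tabulate⁺ {f = spoke′} (punchOut c≢v)) (inj₂ (w∈spoke c≢v))
  spokes-dominate (inj₂ e) with edge-is-spoke e
  ... | i , spoke-i≡e = lose (∈-tabulate⁺ {f = spoke′} i) (inj₁ (cong inj₂ spoke-i≡e))

  -- No element of M(G) dominates two different leaves: two leaves are
  -- not adjacent, hence not both endpoints of one edge.
  leaves-separated : ∀ s {i j} → Dominates (Middle G) s (inj₁ (leaf i)) →
                     Dominates (Middle G) s (inj₁ (leaf j)) → i ≡ j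
  leaves-separated (inj₁ _) (inj₁ p) (inj₁ q) = punchIn-injective c _ _ (inj₁-injective (trans (sym p) q))
  leaves-separated (inj₂ e) {i} {j} (inj₂ ie) (inj₂ je) with leaf i ≟ leaf j
  ... | yes same   = punchIn-injective c i j same
  ... | no  differ = ⊥-elim (avoids-none _ _ (leaf≢c i) (leaf≢c j) (endpoints-adjacent G e ie je differ))

  -- spokes is a dominating set of size k + 1, and the k + 1 leaves force
  -- every dominating set to be at least that large
  domination-number : IsDominationNumber (Middle G) (suc k)
  domination-number =
    (spokes , Unique.tabulate⁺ {f = spoke′} spoke-injective , spokes-dominate , length-tabulate spoke′) ,
    λ S _ S-dominates → dominating-lower-bound (Middle G) (inj₁ ∘ leaf) leaves-separated S S-dominates

NoDisjointEdges : ∀ {n} → SimpleGraph n → Set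
NoDisjointEdges G = ∀ {a b c d} → T (adj G a b) → T (adj G c d) → a ≢ c → a ≢ d → b ≢ c → b ≢ d → ⊥

-- (⇐, step 1) Two disjoint edges ab and cd give the dominating set
-- {ab, cd} ∪ (V ∖ {a, b, c, d}) of M(G), of size n − 2.
module DisjointEdges {n} (G : SimpleGraph n) {a b c d}
    (ab : T (adj G a b)) (cd : T (adj G c d)) (a≢c : a ≢ c) (a≢d : a ≢ d) (b≢c : b ≢ c) (b≢d : b ≢ d) where
  open import Data.List.Membership.DecPropositional (_≟_ {n}) using (_∈?_)

  edge-ab : EdgeBetween G a b
  edge-ab = edgeBetween G a b ab

  edge-cd : EdgeBetween G c d
  edge-cd = edgeBetween G c d cd

  open EdgeBetween

  quad : List (Fin n)
  quad = a ∷ b ∷ c ∷ d ∷ []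

  quad-unique : Unique quad
  quad-unique = (adj⇒≢ G ab ∷ a≢c ∷ a≢d ∷ []) ∷ (b≢c ∷ b≢d ∷ []) ∷ (adj⇒≢ G cd ∷ []) ∷ [] ∷ []

  rest : Complement quad
  rest = complement quad quad-unique

  vertices : List (Fin n ⊎ Edge G)
  vertices = map inj₁ (Complement.points rest)

  S : List (Fin n ⊎ Edge G)
  S = inj₂ (edge edge-ab) ∷ inj₂ (edge edge-cd) ∷ vertices

  ab≢cd : _≢_ {A = Fin n ⊎ Edge G} (inj₂ (edge edge-ab)) (inj₂ (edge edge-cd))
  ab≢cd same with ends-only edge-cd a (subst (_∈ₑ_ G a) (inj₂-injective same) (first-end edge-ab))
  ... | inj₁ a≡c = a≢c a≡c
  ... | inj₂ a≡d = a≢d a≡d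

  edge∉vertices : ∀ (e : Edge G) → All (inj₂ e ≢_) vertices
  edge∉vertices e = All.map⁺ (universal (λ _ ()) (Complement.points rest))

  S-unique : Unique S
  S-unique = (ab≢cd ∷ edge∉vertices _) ∷ edge∉vertices _ ∷ Unique.map⁺ inj₁-injective (Complement.unique rest)

  at-quad : ∀ {x} → x ∈ quad → (P : Fin n ⊎ Edge G → Set) → (∀ {e} → _∈ₑ_ G x e → P (inj₂ e)) → Any P S
  at-quad (here refl)                         P endpoint = here (endpoint (first-end edge-ab))
  at-quad (there (here refl))                 P endpoint = here (endpoint (other-end edge-ab))
  at-quad (there (there (here refl)))         P endpoint = there (here (endpoint (first-end edge-cd)))
  at-quad (there (there (there (here refl)))) P endpoint = there (here (endpoint (other-end edge-cd)))

  off-quad : ∀ {x} → x ∉ quad → (P : Fin n ⊎ Edge G → Set) → P (inj₁ x) → Any P S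
  off-quad x∉ P px = there (there (lose (∈-map⁺ inj₁ (Complement.covers rest _ x∉)) px))

  S-dominates : Dominating (Middle G) S
  S-dominates (inj₁ v) with v ∈? quad
  ... | yes v∈ = at-quad v∈ _ inj₂
  ... | no  v∉ = off-quad v∉ _ (inj₁ refl)
  S-dominates (inj₂ e@((p , _) , _)) with p ∈? quad
  ... | yes p∈ = at-quad p∈ _ (λ {f} p∈f → touching-edges G f e p∈f (inj₁ refl))
  ... | no  p∉ = off-quad p∉ _ (inj₂ (inj₁ refl))

  S-length : suc (suc (length S)) ≡ n
  S-length = trans (cong (λ l → 4 + l) (length-map inj₁ (Complement.points rest))) (Complement.length-sum rest)

domination⇒no-disjoint-edges : ∀ {n} (G : SimpleGraph n) →
  IsDominationNumber (Middle G) (n ∸ 1) → NoDisjointEdges G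
domination⇒no-disjoint-edges G (_ , minimal) ab cd a≢c a≢d b≢c b≢d =
  n≮n (length S) (subst (λ m → m ∸ 1 ≤ length S) (sym S-length) (minimal S S-unique S-dominates))
  where open DisjointEdges G ab cd a≢c a≢d b≢c b≢d

-- (⇐, step 3) Star recognition: without disjoint edges and without
-- isolated vertices, a vertex with three neighbours is a star centre, and
-- such a vertex exists as soon as there are four vertices.
module Recognition {n} (G : SimpleGraph n) (no-disjoint : NoDisjointEdges G)
                   (neighbour-of : ∀ v → Σ (Fin n) λ w → T (adj G v w)) where

  meets : ∀ {a b c d} → T (adj G a b) → T (adj G c d) → a ≢ c → a ≢ d → (b ≡ c) ⊎ (b ≡ d)
  meets {b = b} {c} {d} ab cd a≢c a≢d with b ≟ c | b ≟ d
  ... | yes b≡c | _       = inj₁ b≡c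
  ... | no _    | yes b≡d = inj₂ b≡d
  ... | no b≢c  | no b≢d  = ⊥-elim (no-disjoint ab cd a≢c a≢d b≢c b≢d)

  -- An edge uv avoiding c would have to contain all three neighbours of c;
  -- so every edge contains c, and then every vertex's neighbour is c.
  three-neighbours⇒centre : ∀ {c x y z} → T (adj G c x) → T (adj G c y) → T (adj G c z) →
    x ≢ y → x ≢ z → y ≢ z → IsStarCentre G c
  three-neighbours⇒centre {c} cx cy cz x≢y x≢z y≢z = star-centred hub avoids-none
    where
    avoids-none : ∀ u v → u ≢ c → v ≢ c → ¬ T (adj G u v)
    avoids-none u v u≢c v≢c uv = three-into-two x≢y x≢z y≢z (on-uv cx) (on-uv cy) (on-uv cz)
      where
      on-uv : ∀ {w} → T (adj G c w) → (w ≡ u) ⊎ (w ≡ v)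
      on-uv cw = meets cw uv (≢-sym u≢c) (≢-sym v≢c)

    hub : ∀ v → v ≢ c → T (adj G c v)
    hub v v≢c with neighbour-of v
    ... | w , vw with w ≟ c
    ...   | yes refl = adj-sym G vw
    ...   | no  w≢c  = ⊥-elim (avoids-none v w v≢c w≢c vw)

  -- Given an edge ab and two vertices y ≠ z off it: the neighbours of y and
  -- z lie in {a, b}, and must coincide (else ya, zb are disjoint); that
  -- common neighbour has three neighbours.
  centre-near-edge : ∀ {a b y z} → T (adj G a b) → y ≢ z → y ≢ a → y ≢ b → z ≢ a → z ≢ b →
    Σ (Fin n) (IsStarCentre G)
  centre-near-edge {a} {b} {y} {z} ab y≢z y≢a y≢b z≢a z≢b
    with neighbour-of y | neighbour-of z
  ... | y′ , yy′ | z′ , zz′ with meets yy′ ab y≢a y≢b | meets zz′ ab z≢a z≢b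
  ... | inj₁ refl | inj₁ refl =
    a , three-neighbours⇒centre ab (adj-sym G yy′) (adj-sym G zz′) (≢-sym y≢b) (≢-sym z≢b) y≢z
  ... | inj₂ refl | inj₂ refl =
    b , three-neighbours⇒centre (adj-sym G ab) (adj-sym G yy′) (adj-sym G zz′) (≢-sym y≢a) (≢-sym z≢a) y≢z
  ... | inj₁ refl | inj₂ refl = ⊥-elim (no-disjoint yy′ zz′ y≢z y≢b (≢-sym z≢a) (adj⇒≢ G ab))
  ... | inj₂ refl | inj₁ refl = ⊥-elim (no-disjoint yy′ zz′ y≢z y≢a (≢-sym z≢b) (adj⇒≢ G ab ∘ sym))

-- A graph on at least four vertices with no isolated vertex and no two
-- disjoint edges is a star: take the edge at vertex 0 and two of the
-- vertices 1, 2, 3 off it.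
star-recognition : ∀ {m} (G : SimpleGraph (suc (suc (suc (suc m))))) → NoDisjointEdges G →
  (∀ v → Σ _ λ w → T (adj G v w)) → Σ _ (IsStarCentre G)
star-recognition G no-disjoint neighbour-of = from-edge-at-0 (neighbour-of 0F)
  where
  open Recognition G no-disjoint neighbour-of

  from-edge-at-0 : Σ _ (λ b → T (adj G 0F b)) → Σ _ (IsStarCentre G)
  from-edge-at-0 (b , 0b) with b ≟ 1F | b ≟ 2F
  ... | yes refl | _        = centre-near-edge {y = 2F} {3F} 0b (λ ()) (λ ()) (λ ()) (λ ()) (λ ())
  ... | no _     | yes refl = centre-near-edge {y = 1F} {3F} 0b (λ ()) (λ ()) (λ ()) (λ ()) (λ ())
  ... | no b≢1   | no b≢2   = centre-near-edge {y = 1F} {2F} 0b (λ ()) (λ ()) (b≢1 ∘ sym) (λ ()) (b≢2 ∘ sym)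

theorem3p2 : (n : ℕ) → 4 ≤ n → (G : SimpleGraph n) → Connected G →
    (G ≅ Star n) ⇔ IsDominationNumber (Middle G) (n ∸ 1)
theorem3p2 .(suc (suc (suc (suc _)))) (s≤s (s≤s (s≤s (s≤s _)))) G connected = mk⇔ star⇒γ γ⇒star
  where
  star⇒γ : G ≅ Star _ → IsDominationNumber (Middle G) _
  star⇒γ iso = StarDomination.domination-number G (proj₂ (star-iso⇒centre G iso))

  γ⇒star : IsDominationNumber (Middle G) _ → G ≅ Star _
  γ⇒star γ = centre⇒star-iso G (proj₂ (star-recognition G no-disjoint (neighbour G connected)))
    where
    no-disjoint : NoDisjointEdges G
    no-disjoint = domination⇒no-disjoint-edges G γ
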